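{- For every integer $n\ge 3$, the strong $3$-colour graph $S_3(C_n)$ of the cycle $C_n$ on $n$ vertices is not connected.
   Context: A proper $k$-colouring of a graph $G$ is a map $V(G)\to\{1,\dots,k\}$ giving adjacent vertices different colours; it is strong if all $k$ colours appear. The strong $k$-colour graph $S_k(G)$ has the strong $k$-colourings of $G$ as vertices, two being adjacent iff they differ in colour on exactly one vertex of $G$. -}

module Defs where

open import Data.Nat using (ℕ; suc; _∸_)
open import Data.Fin using (Fin; toℕ)
open import Data.Sum using (_⊎_)
open import Data.Product using (Σ; ∃; _×_; _,_; proj₁)
open import Relation.Binary.PropositionalEquality using (_≡_; _≢_)
open import Relation.Binary.Construct.Closure.ReflexiveTransitive using (Star)

CycleSucc : (n : ℕ) → Fin n → Fin n → Set
CycleSucc n i j = (toℕ j ≡ suc (toℕ i)) ⊎ ((toℕ i ≡ n ∸ 1) × (toℕ j ≡ 0))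

CycleAdj : (n : ℕ) → Fin n → Fin n → Set
CycleAdj n i j = CycleSucc n i j ⊎ CycleSucc n j i

-- A k-colouring of the vertices of C_n (colours {1..k} represented by Fin k).
Colouring : ℕ → ℕ → Set
Colouring n k = Fin n → Fin k

Proper : (n k : ℕ) → Colouring n k → Set
Proper n k c = ∀ i j → CycleAdj n i j → c i ≢ c j

Strong : (n k : ℕ) → Colouring n k → Set
Strong n k c = Proper n k c × (∀ (x : Fin k) → ∃ λ i → c i ≡ x)

SVertex : (n k : ℕ) → Set
SVertex n k = Σ (Colouring n k) (Strong n k)

SAdj : (n k : ℕ) → SVertex n k → SVertex n k → Set
SAdj n k x y =
  ∃ λ v → (proj₁ x v ≢ proj₁ y v) × (∀ w → w ≢ v → proj₁ x w ≡ proj₁ y w)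

SConnected : (n k : ℕ) → Set
SConnected n k = ∀ (x y : SVertex n k) → Star (SAdj n k) x y

-- Orient C_n as 0 → 1 → ⋯ → n − 1 → 0. In a proper 3-colouring each edge either ascends
-- (from colour c to c + 1 mod 3) or descends, and the number of ascents is invariant in
-- S_3(C_n): a vertex can only be recoloured when both its neighbours carry the colour
-- differing from its old and its new colour, and then exactly one of its two edges ascends,
-- before and after. Exchanging colours 1 and 2 turns ascents into descents, so a colouring
-- with a ascents and its mirror image lie in different components unless 2a = n.
-- The staircase colouring 0, 1, 2, 0, 1, 2, … closed by one further colour has at least
-- n − 2 ascents, which settles n ≥ 5 (and n = 3 by direct count). For n = 4 the staircase
-- colouring 1, 0, 1, 2 is frozen: every vertex either has a colour used nowhere else or
-- sees both other colours on its neighbours.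
module Submission where

open import Defs
open import Data.Fin using (Fin; zero; suc; toℕ; fromℕ; inject₁; lower₁; punchIn; _≟_)
open import Data.Fin.Patterns using (0F; 1F; 2F; 3F)
open import Data.Fin.Permutation using (Permutation′; transpose; _⟨$⟩ʳ_; _⟨$⟩ˡ_; inverseˡ; inverseʳ)
open import Data.Fin.Properties
  using (toℕ-injective; toℕ-fromℕ; toℕ-inject₁; toℕ-lower₁; toℕ<n; punchInᵢ≢i)
open import Data.Nat using (ℕ; zero; suc; _+_; _≤_; _<_; _≥_; z≤n; s≤s)
open import Data.Nat.Properties
  using ( +-0-commutativeMonoid; +-comm; +-assoc; +-cancelʳ-≡; +-cancelʳ-≤; +-mono-≤
        ; m≤n+m; ≤-trans; module ≤-Reasoning; <⇒≢; n<1+n; 1+n≢0)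
  renaming (_≟_ to _≟ℕ_; suc-injective to ℕ-suc-injective)
open import Algebra.Properties.CommutativeMonoid.Sum +-0-commutativeMonoid
  using (sum; sum-remove; sum-cong-≗; ∑-distrib-+)
open import Data.Product using (∃; _×_; _,_; proj₁)
open import Data.Sum using (_⊎_; inj₁; inj₂)
open import Data.Vec.Functional using (Vector; updateAt; tail)
open import Data.Vec.Functional.Properties using (updateAt-updates; updateAt-minimal)
open import Function using (_∘_; _on_)
open import Relation.Binary.Construct.Closure.ReflexiveTransitive using (Star; ε; _◅_; fold)
open import Relation.Binary.PropositionalEquality
open import Relation.Nullary using (¬_; contradiction; yes; no)

private
  variable
    k m n : ℕ

ascent : Fin 3 → Fin 3 → ℕ
ascent 0F 1F = 1
ascent 1F 2F = 1
ascent 2F 0F = 1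
ascent _  _  = 0

ascent-flip : ∀ {a b} → a ≢ b → ascent a b + ascent b a ≡ 1
ascent-flip {0F} {0F} a≢b = contradiction refl a≢b
ascent-flip {0F} {1F} _   = refl
ascent-flip {0F} {2F} _   = refl
ascent-flip {1F} {0F} _   = refl
ascent-flip {1F} {1F} a≢b = contradiction refl a≢b
ascent-flip {1F} {2F} _   = refl
ascent-flip {2F} {0F} _   = refl
ascent-flip {2F} {1F} _   = refl
ascent-flip {2F} {2F} a≢b = contradiction refl a≢b

ascent≡1⇒≢ : ∀ {a b} → ascent a b ≡ 1 → a ≢ b
ascent≡1⇒≢ {0F} () refl
ascent≡1⇒≢ {1F} () refl
ascent≡1⇒≢ {2F} () refl

third : Fin 3 → Fin 3 → Fin 3
third 0F 1F = 2F
third 1F 0F = 2F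
third 0F 2F = 1F
third 2F 0F = 1F
third _  _  = 0F

≢⇒≡third : ∀ {a b c} → a ≢ b → c ≢ a → c ≢ b → c ≡ third a b
≢⇒≡third {0F} {0F} a≢b _ _ = contradiction refl a≢b
≢⇒≡third {1F} {1F} a≢b _ _ = contradiction refl a≢b
≢⇒≡third {2F} {2F} a≢b _ _ = contradiction refl a≢b
≢⇒≡third {0F} {1F} {0F} _ c≢a _ = contradiction refl c≢a
≢⇒≡third {0F} {1F} {1F} _ _ c≢b = contradiction refl c≢b
≢⇒≡third {0F} {1F} {2F} _ _ _   = refl
≢⇒≡third {0F} {2F} {0F} _ c≢a _ = contradiction refl c≢a
≢⇒≡third {0F} {2F} {1F} _ _ _   = refl
≢⇒≡third {0F} {2F} {2F} _ _ c≢b = contradiction refl c≢b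
≢⇒≡third {1F} {0F} {0F} _ _ c≢b = contradiction refl c≢b
≢⇒≡third {1F} {0F} {1F} _ c≢a _ = contradiction refl c≢a
≢⇒≡third {1F} {0F} {2F} _ _ _   = refl
≢⇒≡third {1F} {2F} {0F} _ _ _   = refl
≢⇒≡third {1F} {2F} {1F} _ c≢a _ = contradiction refl c≢a
≢⇒≡third {1F} {2F} {2F} _ _ c≢b = contradiction refl c≢b
≢⇒≡third {2F} {0F} {0F} _ _ c≢b = contradiction refl c≢b
≢⇒≡third {2F} {0F} {1F} _ _ _   = refl
≢⇒≡third {2F} {0F} {2F} _ c≢a _ = contradiction refl c≢a
≢⇒≡third {2F} {1F} {0F} _ _ _   = refl
≢⇒≡third {2F} {1F} {1F} _ _ c≢b = contradiction refl c≢b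
≢⇒≡third {2F} {1F} {2F} _ c≢a _ = contradiction refl c≢a

-- Both neighbours a, a′ of a vertex recoloured from b to b′ carry the third colour,
-- and of the two edges between that colour and b (or b′) exactly one ascends.
ascent-recolour : ∀ {a a′ b b′} → b ≢ b′ → a ≢ b → a ≢ b′ → a′ ≢ b → a′ ≢ b′ →
                  ascent a b + ascent b a′ ≡ ascent a b′ + ascent b′ a′
ascent-recolour b≢b′ a≢b a≢b′ a′≢b a′≢b′
  rewrite trans (≢⇒≡third b≢b′ a′≢b a′≢b′) (sym (≢⇒≡third b≢b′ a≢b a≢b′))
  = trans (ascent-flip a≢b) (sym (ascent-flip a≢b′))

mirror : Permutation′ 3
mirror = transpose 1F 2F

ascent-mirror : ∀ a b → ascent (mirror ⟨$⟩ʳ a) (mirror ⟨$⟩ʳ b) ≡ ascent b a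
ascent-mirror 0F 0F = refl
ascent-mirror 0F 1F = refl
ascent-mirror 0F 2F = refl
ascent-mirror 1F 0F = refl
ascent-mirror 1F 1F = refl
ascent-mirror 1F 2F = refl
ascent-mirror 2F 0F = refl
ascent-mirror 2F 1F = refl
ascent-mirror 2F 2F = refl

sum-update : (f g : Vector ℕ (suc n)) (a : Fin (suc n)) → (∀ i → i ≢ a → f i ≡ g i) →
             sum f + g a ≡ sum g + f a
sum-update f g a f≗g = begin
  sum f + g a                        ≡⟨ cong (_+ g a) (sum-remove f) ⟩
  (f a + sum (f ∘ punchIn a)) + g a  ≡⟨ cong (λ s → (f a + s) + g a) f≗g-off-a ⟩
  (f a + sum (g ∘ punchIn a)) + g a  ≡⟨ +-comm (f a + _) (g a) ⟩
  g a + (f a + sum (g ∘ punchIn a))  ≡⟨ cong (g a +_) (+-comm (f a) _) ⟩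
  g a + (sum (g ∘ punchIn a) + f a)  ≡⟨ +-assoc (g a) _ (f a) ⟨
  (g a + sum (g ∘ punchIn a)) + f a  ≡⟨ cong (_+ f a) (sum-remove g) ⟨
  sum g + f a                        ∎
  where
  open ≡-Reasoning
  f≗g-off-a : sum (f ∘ punchIn a) ≡ sum (g ∘ punchIn a)
  f≗g-off-a = sum-cong-≗ (λ j → f≗g (punchIn a j) (punchInᵢ≢i a j))

sum-update₂ : (f g : Vector ℕ (suc n)) {p v : Fin (suc n)} → p ≢ v →
              (∀ i → i ≢ p → i ≢ v → f i ≡ g i) → f p + f v ≡ g p + g v → sum f ≡ sum g
sum-update₂ {n} f g {p} {v} p≢v f≗g fp+fv≡gp+gv = +-cancelʳ-≡ _ _ _ (begin
  sum f + (f p + f v)  ≡⟨ cong (sum f +_) fp+fv≡gp+gv ⟩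
  sum f + (g p + g v)  ≡⟨ +-assoc (sum f) (g p) (g v) ⟨
  sum f + g p + g v    ≡⟨ cong (λ t → sum f + t + g v) (updateAt-updates p f) ⟨
  sum f + h p + g v    ≡⟨ cong (_+ g v) (sum-update f h p (λ i i≢p → sym (updateAt-minimal i p f i≢p))) ⟩
  sum h + f p + g v    ≡⟨ +-assoc (sum h) (f p) (g v) ⟩
  sum h + (f p + g v)  ≡⟨ cong (sum h +_) (+-comm (f p) (g v)) ⟩
  sum h + (g v + f p)  ≡⟨ +-assoc (sum h) (g v) (f p) ⟨
  sum h + g v + f p    ≡⟨ cong (_+ f p) (sum-update h g v h≗g) ⟩
  sum g + h v + f p    ≡⟨ cong (λ t → sum g + t + f p) (updateAt-minimal v p f (p≢v ∘ sym)) ⟩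
  sum g + f v + f p    ≡⟨ +-assoc (sum g) (f v) (f p) ⟩
  sum g + (f v + f p)  ≡⟨ cong (sum g +_) (+-comm (f v) (f p)) ⟩
  sum g + (f p + f v)  ∎)
  where
  open ≡-Reasoning
  h : Vector ℕ (suc n)
  h = updateAt f p (λ _ → g p)
  h≗g : ∀ i → i ≢ v → h i ≡ g i
  h≗g i i≢v with i ≟ p
  ... | yes refl = updateAt-updates p f
  ... | no i≢p   = trans (updateAt-minimal i p f i≢p) (f≗g i i≢p i≢v)

sum-complement : (f g : Vector ℕ n) → (∀ i → f i + g i ≡ 1) → sum f + sum g ≡ n
sum-complement {n} f g f+g≡1 = begin
  sum f + sum g          ≡⟨ ∑-distrib-+ f g ⟨
  sum (λ i → f i + g i)  ≡⟨ sum-cong-≗ f+g≡1 ⟩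
  sum {n} (λ _ → 1)      ≡⟨ sum-ones n ⟩
  n                      ∎
  where
  open ≡-Reasoning
  sum-ones : ∀ n → sum {n} (λ _ → 1) ≡ n
  sum-ones zero    = refl
  sum-ones (suc n) = cong suc (sum-ones n)

sum-≥-prefix : (f : Vector ℕ n) (k : ℕ) → k ≤ n → (∀ i → toℕ i < k → f i ≡ 1) → k ≤ sum f
sum-≥-prefix f zero    _         _    = z≤n
sum-≥-prefix f (suc k) (s≤s k≤n) ones rewrite ones zero (s≤s z≤n) =
  s≤s (sum-≥-prefix (tail f) k k≤n (λ i i<k → ones (suc i) (s≤s i<k)))

CycleSucc-functional : ∀ {i j j′ : Fin n} → CycleSucc n i j → CycleSucc n i j′ → j ≡ j′
CycleSucc-functional (inj₁ j≡1+i) (inj₁ j′≡1+i) = toℕ-injective (trans j≡1+i (sym j′≡1+i))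
CycleSucc-functional {suc m} {j = j} (inj₁ j≡1+i) (inj₂ (i≡m , _)) =
  contradiction (trans j≡1+i (cong suc i≡m)) (<⇒≢ (toℕ<n j))
CycleSucc-functional {suc m} {j′ = j′} (inj₂ (i≡m , _)) (inj₁ j′≡1+i) =
  contradiction (trans j′≡1+i (cong suc i≡m)) (<⇒≢ (toℕ<n j′))
CycleSucc-functional (inj₂ (_ , j≡0)) (inj₂ (_ , j′≡0)) = toℕ-injective (trans j≡0 (sym j′≡0))

CycleSucc-injective : ∀ {i i′ j : Fin n} → CycleSucc n i j → CycleSucc n i′ j → i ≡ i′
CycleSucc-injective (inj₁ j≡1+i) (inj₁ j≡1+i′) =
  toℕ-injective (ℕ-suc-injective (trans (sym j≡1+i) j≡1+i′))
CycleSucc-injective (inj₁ j≡1+i) (inj₂ (_ , j≡0)) = contradiction (trans (sym j≡1+i) j≡0) 1+n≢0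
CycleSucc-injective (inj₂ (_ , j≡0)) (inj₁ j≡1+i′) = contradiction (trans (sym j≡1+i′) j≡0) 1+n≢0
CycleSucc-injective (inj₂ (i≡last , _)) (inj₂ (i′≡last , _)) =
  toℕ-injective (trans i≡last (sym i′≡last))

CycleSucc-irrefl : ∀ {i : Fin (suc (suc m))} → ¬ CycleSucc (suc (suc m)) i i
CycleSucc-irrefl (inj₁ i≡1+i) = <⇒≢ (n<1+n _) i≡1+i
CycleSucc-irrefl (inj₂ (i≡1+m , i≡0)) = 1+n≢0 (trans (sym i≡1+m) i≡0)

next : Fin (suc m) → Fin (suc m)
next {m} i with m ≟ℕ toℕ i
... | yes _   = zero
... | no m≢i = suc (lower₁ i m≢i)

next-succ : (i : Fin (suc m)) → CycleSucc (suc m) i (next i)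
next-succ {m} i with m ≟ℕ toℕ i
... | yes m≡i = inj₂ (sym m≡i , refl)
... | no m≢i  = inj₁ (cong suc (toℕ-lower₁ i m≢i))

toℕ-next : (i : Fin (suc m)) → m ≢ toℕ i → toℕ (next i) ≡ suc (toℕ i)
toℕ-next {m} i m≢i with m ≟ℕ toℕ i
... | yes m≡i = contradiction m≡i m≢i
... | no m≢i  = cong suc (toℕ-lower₁ i m≢i)

prev : Fin (suc m) → Fin (suc m)
prev {m} zero = fromℕ m
prev (suc i)  = inject₁ i

prev-succ : (v : Fin (suc m)) → CycleSucc (suc m) (prev v) v
prev-succ {m} zero = inj₂ (toℕ-fromℕ m , refl)
prev-succ (suc i)  = inj₁ (cong suc (sym (toℕ-inject₁ i)))

next-prev : (v : Fin (suc m)) → next (prev v) ≡ v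
next-prev v = CycleSucc-functional (next-succ (prev v)) (prev-succ v)

ascentAt : Colouring (suc m) 3 → Fin (suc m) → ℕ
ascentAt c i = ascent (c i) (c (next i))

ascents : Colouring (suc m) 3 → ℕ
ascents c = sum (ascentAt c)

ascents-step : {x y : SVertex (suc (suc m)) 3} → SAdj _ 3 x y →
               ascents (proj₁ x) ≡ ascents (proj₁ y)
ascents-step {x = c , c-proper , _} {y = d , d-proper , _} (v , cv≢dv , c≗d) =
  sum-update₂ (ascentAt c) (ascentAt d) p≢v untouched around-v
  where
  p = prev v
  w = next v
  p→v : CycleSucc _ p v
  p→v = prev-succ v
  v→w : CycleSucc _ v w
  v→w = next-succ v
  p≢v : p ≢ v
  p≢v p≡v = CycleSucc-irrefl (subst (λ u → CycleSucc _ u v) p≡v p→v)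
  w≢v : w ≢ v
  w≢v w≡v = CycleSucc-irrefl (subst (CycleSucc _ v) w≡v v→w)
  untouched : ∀ i → i ≢ p → i ≢ v → ascentAt c i ≡ ascentAt d i
  untouched i i≢p i≢v = cong₂ ascent (c≗d i i≢v) (c≗d (next i) next-i≢v)
    where
    next-i≢v : next i ≢ v
    next-i≢v next-i≡v = i≢p (CycleSucc-injective (subst (CycleSucc _ i) next-i≡v (next-succ i)) p→v)
  around-v : ascentAt c p + ascentAt c v ≡ ascentAt d p + ascentAt d v
  around-v rewrite next-prev v | c≗d p p≢v | c≗d w w≢v =
    ascent-recolour cv≢dv
      (λ dp≡cv → c-proper p v (inj₁ p→v) (trans (c≗d p p≢v) dp≡cv))
      (d-proper p v (inj₁ p→v))
      (λ dw≡cv → c-proper v w (inj₁ v→w) (sym (trans (c≗d w w≢v) dw≡cv)))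
      (λ dw≡dv → d-proper v w (inj₁ v→w) (sym dw≡dv))

ascents-invariant : {x y : SVertex (suc (suc m)) 3} → Star (SAdj _ 3) x y →
                    ascents (proj₁ x) ≡ ascents (proj₁ y)
ascents-invariant =
  fold (_≡_ on (ascents ∘ proj₁)) (λ {x} {z} x~z → trans (ascents-step {x = x} {y = z} x~z)) refl

recolour : Permutation′ k → SVertex n k → SVertex n k
recolour π (c , c-proper , c-onto) =
  (π ⟨$⟩ʳ_) ∘ c ,
  (λ i j i~j πci≡πcj →
     c-proper i j i~j (trans (sym (inverseˡ π)) (trans (cong (π ⟨$⟩ˡ_) πci≡πcj) (inverseˡ π)))) ,
  λ a → let (i , ci≡π⁻¹a) = c-onto (π ⟨$⟩ˡ a) in i , trans (cong (π ⟨$⟩ʳ_) ci≡π⁻¹a) (inverseʳ π)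

ascents-mirror : (x : SVertex (suc m) 3) →
                 ascents (proj₁ x) + ascents (proj₁ (recolour mirror x)) ≡ suc m
ascents-mirror (c , c-proper , _) =
  sum-complement (ascentAt c) (ascentAt ((mirror ⟨$⟩ʳ_) ∘ c)) λ i →
    trans (cong (ascentAt c i +_) (ascent-mirror (c i) (c (next i))))
          (ascent-flip (c-proper i (next i) (inj₁ (next-succ i))))

Locked : Colouring n k → Fin n → Set
Locked {n} c v = (∀ w → w ≢ v → c w ≢ c v) ⊎ (∀ a → a ≢ c v → ∃ λ u → CycleAdj n v u × c u ≡ a)

locked⇒isolated : (x : SVertex n k) → (∀ v → Locked (proj₁ x) v) → ∀ y → ¬ SAdj n k x y
locked⇒isolated (c , _) locked (d , d-proper , d-onto) (v , cv≢dv , c≗d) with locked v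
... | inj₁ cv-unique with d-onto (c v)
...   | u , du≡cv with u ≟ v
...     | yes refl = cv≢dv (sym du≡cv)
...     | no u≢v   = cv-unique u u≢v (trans (c≗d u u≢v) du≡cv)
locked⇒isolated (c , _) locked (d , d-proper , d-onto) (v , cv≢dv , c≗d) | inj₂ neighbours-see-all
  with neighbours-see-all (d v) (cv≢dv ∘ sym)
... | u , v~u , cu≡dv with u ≟ v
...   | yes refl = cv≢dv cu≡dv
...   | no u≢v   = d-proper v u v~u (sym (trans (sym (c≗d u u≢v)) cu≡dv))

isolated⇒unreachable : {x y : SVertex n k} → (∀ z → ¬ SAdj n k x z) → Star (SAdj n k) x y → x ≡ y
isolated⇒unreachable isolated ε = refl
isolated⇒unreachable isolated (_◅_ {j = z} x~z _) = contradiction x~z (isolated z)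

mod3 : ℕ → Fin 3
mod3 0 = 0F
mod3 1 = 1F
mod3 2 = 2F
mod3 (suc (suc (suc a))) = mod3 a

ascent-mod3 : ∀ a → ascent (mod3 a) (mod3 (suc a)) ≡ 1
ascent-mod3 0 = refl
ascent-mod3 1 = refl
ascent-mod3 2 = refl
ascent-mod3 (suc (suc (suc a))) = ascent-mod3 a

closingColour : Fin 3 → Fin 3
closingColour 1F = 2F
closingColour _  = 1F

closingColour-≢ : ∀ a → closingColour a ≢ a
closingColour-≢ 0F ()
closingColour-≢ 1F ()
closingColour-≢ 2F ()

closingColour-≢0 : ∀ a → closingColour a ≢ 0F
closingColour-≢0 0F ()
closingColour-≢0 1F ()
closingColour-≢0 2F ()

-- Vertex 0 closes the cycle; vertices 1, …, k + 2 are coloured 0, 1, 2, 0, 1, 2, …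
staircaseColourAt : ℕ → ℕ → Fin 3
staircaseColourAt k zero    = closingColour (mod3 (suc k))
staircaseColourAt k (suc a) = mod3 a

staircaseColourAt-≢ : ∀ k a → staircaseColourAt k a ≢ staircaseColourAt k (suc a)
staircaseColourAt-≢ k zero    = closingColour-≢0 (mod3 (suc k))
staircaseColourAt-≢ k (suc a) = ascent≡1⇒≢ (ascent-mod3 a)

staircase : ∀ k → SVertex (3 + k) 3
staircase k = colour , proper , onto
  where
  colour : Colouring (3 + k) 3
  colour i = staircaseColourAt k (toℕ i)
  succ-≢ : ∀ i j → CycleSucc (3 + k) i j → colour i ≢ colour j
  succ-≢ i j (inj₁ j≡1+i) rewrite j≡1+i = staircaseColourAt-≢ k (toℕ i)
  succ-≢ i j (inj₂ (i≡last , j≡0)) rewrite i≡last | j≡0 = closingColour-≢ (mod3 (suc k)) ∘ sym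
  proper : Proper (3 + k) 3 colour
  proper i j (inj₁ i→j) = succ-≢ i j i→j
  proper i j (inj₂ j→i) = succ-≢ j i j→i ∘ sym
  onto : ∀ a → ∃ λ i → colour i ≡ a
  onto 0F = 1F , refl
  onto 1F = 2F , refl
  onto 2F = two k
    where
    two : ∀ k → ∃ λ (i : Fin (3 + k)) → staircaseColourAt k (toℕ i) ≡ 2F
    two zero    = 0F , refl
    two (suc k) = 3F , refl

staircase-ascents-≥ : ∀ k → suc k ≤ ascents (proj₁ (staircase k))
staircase-ascents-≥ k = ≤-trans (sum-≥-prefix _ (suc k) (s≤s (m≤n+m k 1)) ascending) (m≤n+m _ _)
  where
  ascending : ∀ i → toℕ i < suc k → ascentAt (proj₁ (staircase k)) (suc i) ≡ 1
  ascending i (s≤s i≤k) rewrite toℕ-next (suc i) (<⇒≢ (s≤s (s≤s i≤k)) ∘ sym) = ascent-mod3 (toℕ i)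

staircase-mirror-ascents-≢ : ∀ k → ascents (proj₁ (staircase (2 + k))) ≢
                                   ascents (proj₁ (recolour mirror (staircase (2 + k))))
staircase-mirror-ascents-≢ k same = 3+k≰2 (+-cancelʳ-≤ (3 + k) (3 + k) 2 (begin
  (3 + k) + (3 + k)  ≤⟨ +-mono-≤ (staircase-ascents-≥ (2 + k)) (staircase-ascents-≥ (2 + k)) ⟩
  a + a              ≡⟨ cong (a +_) same ⟩
  a + a′             ≡⟨ ascents-mirror (staircase (2 + k)) ⟩
  5 + k              ∎))
  where
  open ≤-Reasoning
  a = ascents (proj₁ (staircase (2 + k)))
  a′ = ascents (proj₁ (recolour mirror (staircase (2 + k))))
  3+k≰2 : ¬ 3 + k ≤ 2
  3+k≰2 (s≤s (s≤s ()))

staircase-1-locked : ∀ v → Locked (proj₁ (staircase 1)) v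
staircase-1-locked 0F = inj₂ λ where
  0F _   → 1F , inj₁ (inj₁ refl) , refl
  1F 1≢1 → contradiction refl 1≢1
  2F _   → 3F , inj₂ (inj₂ (refl , refl)) , refl
staircase-1-locked 1F = inj₁ λ where
  0F _   ()
  1F 1≢1 → contradiction refl 1≢1
  2F _   ()
  3F _   ()
staircase-1-locked 2F = inj₂ λ where
  0F _   → 1F , inj₂ (inj₁ refl) , refl
  1F 1≢1 → contradiction refl 1≢1
  2F _   → 3F , inj₁ (inj₁ refl) , refl
staircase-1-locked 3F = inj₁ λ where
  0F _   ()
  1F _   ()
  2F _   ()
  3F 3≢3 → contradiction refl 3≢3

ascents-differ⇒¬connected : (x y : SVertex (suc (suc m)) 3) →
                            ascents (proj₁ x) ≢ ascents (proj₁ y) → ¬ SConnected (suc (suc m)) 3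
ascents-differ⇒¬connected x y differ connected = differ (ascents-invariant (connected x y))

proposition4p2 : (n : ℕ) → n ≥ 3 → ¬ SConnected n 3
proposition4p2 0 ()
proposition4p2 1 (s≤s ())
proposition4p2 2 (s≤s (s≤s ()))
proposition4p2 3 _ = ascents-differ⇒¬connected (staircase 0) (recolour mirror (staircase 0)) (λ ())
proposition4p2 4 _ connected
  with cong (λ x → proj₁ x 2F)
         (isolated⇒unreachable (locked⇒isolated (staircase 1) staircase-1-locked)
           (connected (staircase 1) (recolour mirror (staircase 1))))
... | ()
proposition4p2 (suc (suc (suc (suc (suc k))))) _ =
  ascents-differ⇒¬connected (staircase (2 + k)) (recolour mirror (staircase (2 + k)))
    (staircase-mirror-ascents-≢ k)
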